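{- Let $T$ be an amenable tableau with content $c(T)=k(k-1)(k-2)\cdots(k-j)$. Then in $w(T)$, $|i'|\le|(i+1)'|$ for all $1\le i\le j$, where $|x|$ denotes the number of occurrences of the letter $x$ in $w(T)$.
   Context: Use the alphabet $1'<1<2'<2<\cdots$. A tableau is a filling of the boxes of a (possibly skew or shifted) diagram by letters of this alphabet. Its reading word $w(T)$ lists entries of each row right to left, rows top to bottom; $\hat w(T)$ is $w(T)$ reversed with each entry replaced by its successor ($i'\mapsto i$, $i\mapsto(i+1)'$). The content $c(T)=c_1c_2\cdots$ has $c_i=|i|+|i'|$. A word is lattice if, whenever the number of $i$'s read so far equals the number of $(i+1)$'s read, the next symbol is neither $i+1$ nor $(i+1)'$. $T$ is amenable if rows and columns weakly increase, each row has at most one $i'$ and each column at most one $i$ for each $i$, the concatenation $w\hat w$ is lattice, and in $w$ the rightmost $i$ is to the right of the rightmost $i'$ for all $i$. -}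

module Defs where

open import Data.Nat using (ℕ; zero; suc; _+_; _∸_; _≤_; _<_; _≥_; _>_; _≡ᵇ_; _≤ᵇ_)
open import Data.Bool using (Bool; true; false; if_then_else_; _∧_)
open import Data.List using (List; []; _∷_; _++_; length; reverse; map; concat; mapMaybe; upTo)
open import Data.Maybe using (Maybe; just; nothing)
open import Data.Product using (_×_)
open import Data.List.Relation.Unary.All using (All)
open import Data.List.Relation.Unary.Linked using (Linked)
open import Data.List.Membership.Propositional using (_∈_)
open import Relation.Binary.PropositionalEquality using (_≡_; _≢_)

-- Alphabet 1' < 1 < 2' < 2 < ...
-- pr i  is the primed letter i',   un i  is the unprimed letter i.
-- Letters of the alphabet have index i ≥ 1 (see ValidLetter).

data Letter : Set where
  pr : ℕ → Letter
  un : ℕ → Letter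

index : Letter → ℕ
index (pr i) = i
index (un i) = i

ValidLetter : Letter → Set
ValidLetter x = 1 ≤ index x

rank : Letter → ℕ
rank (pr i) = i + i
rank (un i) = suc (i + i)

_≤L_ : Letter → Letter → Set
x ≤L y = rank x ≤ rank y

_==L_ : Letter → Letter → Bool
pr i ==L pr j = i ≡ᵇ j
un i ==L un j = i ≡ᵇ j
_    ==L _    = false

next : Letter → Letter
next (pr i) = un i
next (un i) = pr (suc i)

occ : Letter → List Letter → ℕ
occ x []       = 0
occ x (y ∷ ys) = if x ==L y then suc (occ x ys) else occ x ys

-- Rows are numbered 0,1,2,... from the top, columns 0,1,2,... from the left.
-- Row r of the ordinary skew shape λ/μ occupies columns μ_r ≤ c < λ_r;
-- row r of the shifted skew shape λ/μ occupies columns r+μ_r ≤ c < r+λ_r.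

data Kind : Set where
  ordinary shifted : Kind

nth : List ℕ → ℕ → ℕ
nth []       _       = 0
nth (x ∷ xs) zero    = x
nth (x ∷ xs) (suc r) = nth xs r

nthRow : List (List Letter) → ℕ → List Letter
nthRow []       _       = []
nthRow (x ∷ xs) zero    = x
nthRow (x ∷ xs) (suc r) = nthRow xs r

lookupM : List Letter → ℕ → Maybe Letter
lookupM []       _       = nothing
lookupM (x ∷ xs) zero    = just x
lookupM (x ∷ xs) (suc n) = lookupM xs n

IsShapePair : Kind → List ℕ → List ℕ → Set
IsShapePair ordinary la mu = Linked _≥_ la × Linked _≥_ mu × (∀ r → nth mu r ≤ nth la r)
IsShapePair shifted  la mu = Linked _>_ la × Linked _>_ mu × (∀ r → nth mu r ≤ nth la r)

record Tableau : Set where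
  constructor mkTableau
  field
    kind   : Kind
    outer  : List ℕ
    inner  : List ℕ
    rows   : List (List Letter)

open Tableau public

startCol : Tableau → ℕ → ℕ
startCol T r with kind T
... | ordinary = nth (inner T) r
... | shifted  = r + nth (inner T) r

WellFormed : Tableau → Set
WellFormed T =
  IsShapePair (kind T) (outer T) (inner T) ×
  length (rows T) ≡ length (outer T) ×
  (∀ r → length (nthRow (rows T) r) ≡ nth (outer T) r ∸ nth (inner T) r) ×
  All (All ValidLetter) (rows T)

entry : Tableau → ℕ → ℕ → Maybe Letter
entry T r c =
  if startCol T r ≤ᵇ c then lookupM (nthRow (rows T) r) (c ∸ startCol T r) else nothing

column : Tableau → ℕ → List Letter
column T c = mapMaybe (λ r → entry T r c) (upTo (length (rows T)))

w : Tableau → List Letter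
w T = concat (map reverse (rows T))

ŵ : Tableau → List Letter
ŵ T = map next (reverse (w T))

content : Tableau → ℕ → ℕ
content T i = occ (un i) (w T) + occ (pr i) (w T)

Lattice : List Letter → Set
Lattice u = ∀ (p : List Letter) (x : Letter) (s : List Letter) → u ≡ p ++ x ∷ s →
  ∀ i → 1 ≤ i → occ (un i) p ≡ occ (un (suc i)) p →
  (x ≢ un (suc i)) × (x ≢ pr (suc i))

-- in u, the rightmost i lies to the right of the rightmost i'
-- (every occurrence of i' is followed later by an occurrence of i)
RightmostCond : List Letter → Set
RightmostCond u = ∀ i (p s : List Letter) → u ≡ p ++ pr i ∷ s → un i ∈ s

Amenable : Tableau → Set
Amenable T =
  WellFormed T ×
  All (Linked _≤L_) (rows T) ×
  (∀ r c x y → entry T r c ≡ just x → entry T (suc r) c ≡ just y → x ≤L y) ×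
  All (λ row → ∀ i → occ (pr i) row ≤ 1) (rows T) ×
  (∀ c i → occ (un i) (column T c) ≤ 1) ×
  Lattice (w T ++ ŵ T) ×
  RightmostCond (w T)

-- Suppose |i'| > |(i+1)'|. Since c_i = c_{i+1} + 1, this forces |i| ≤ |i+1|.
-- By the rightmost condition some letter i of w comes after every i' of w.
-- In w ŵ, let p be w followed by the successors of the letters after that i:
-- these successors contain no i, so p has |i| letters i and at least |i+1|
-- letters i+1, while the next letter of w ŵ is (i+1)', the successor of that i.
-- The lattice condition makes every prefix have at least as many i as i+1, and
-- forbids reading (i+1)' at a tie, so |i+1| < |i|, a contradiction.
module Submission where

open import Defs
open import Data.Nat using (ℕ; suc; _+_; _≤_; _<_; _≤?_; _≡ᵇ_; z≤n; s≤s)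
open import Data.Nat.Properties
open import Data.Bool using (true; false; T)
open import Data.List using (List; []; _∷_; _++_; _ʳ++_; reverse; map; [_])
open import Data.List.Properties using (++-assoc; ++-identityʳ; ++-ʳ++; ʳ++-defn; map-++)
open import Data.List.Membership.Propositional.Properties using (∈-∃++)
open import Data.Product using (∃₂; _,_; _×_; proj₁; proj₂)
open import Data.Sum using (_⊎_; inj₁; inj₂)
open import Relation.Nullary using (yes; no; contradiction)
open import Relation.Binary.PropositionalEquality hiding ([_])

==L⇒≡ : ∀ {x y} → (x ==L y) ≡ true → x ≡ y
==L⇒≡ {pr m} {pr n} eq = cong pr (≡ᵇ⇒≡ m n (subst T (sym eq) _))
==L⇒≡ {un m} {un n} eq = cong un (≡ᵇ⇒≡ m n (subst T (sym eq) _))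

occ-++ : ∀ x xs ys → occ x (xs ++ ys) ≡ occ x xs + occ x ys
occ-++ x []       ys = refl
occ-++ x (y ∷ xs) ys with x ==L y
... | true  = cong suc (occ-++ x xs ys)
... | false = occ-++ x xs ys

occ-ʳ++ : ∀ x xs ys → occ x (xs ʳ++ ys) ≡ occ x xs + occ x ys
occ-ʳ++ x []       ys = refl
occ-ʳ++ x (y ∷ xs) ys with occ-ʳ++ x xs (y ∷ ys)
... | eq with x ==L y
...   | true  = trans eq (+-suc (occ x xs) (occ x ys))
...   | false = eq

occ-reverse : ∀ x xs → occ x (reverse xs) ≡ occ x xs
occ-reverse x xs = trans (occ-ʳ++ x xs []) (+-identityʳ (occ x xs))

occ-un-map-next : ∀ i xs → occ (un i) (map next xs) ≡ occ (pr i) xs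
occ-un-map-next i []          = refl
occ-un-map-next i (pr n ∷ xs) with i ≡ᵇ n
... | true  = cong suc (occ-un-map-next i xs)
... | false = occ-un-map-next i xs
occ-un-map-next i (un n ∷ xs) = occ-un-map-next i xs

occ-[]≤1 : ∀ x y → occ x [ y ] ≤ 1
occ-[]≤1 x y with x ==L y
... | true  = ≤-refl
... | false = z≤n

occ-[]-≢ : ∀ x y → y ≢ x → occ x [ y ] ≡ 0
occ-[]-≢ x y y≢x with x ==L y in eq
... | true  = contradiction (sym (==L⇒≡ eq)) y≢x
... | false = refl

split-last : ∀ x xs → 1 ≤ occ x xs →
  ∃₂ λ ys zs → xs ≡ ys ++ x ∷ zs × occ x zs ≡ 0
split-last x (y ∷ xs) x∈ with 1 ≤? occ x xs | x ==L y in eq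
... | yes x∈xs | _ =
  let ys , zs , xs≡ , x∉zs = split-last x xs x∈xs in
  y ∷ ys , zs , cong (y ∷_) xs≡ , x∉zs
... | no x∉xs | true  = [] , xs , cong (_∷ xs) (sym (==L⇒≡ eq)) , n<1⇒n≡0 (≰⇒> x∉xs)
... | no x∉xs | false = contradiction x∈ x∉xs

lattice-prefix-ballot : ∀ {u} → Lattice u → ∀ {i} → 1 ≤ i → ∀ p s → u ≡ p ++ s →
  occ (un (suc i)) p ≤ occ (un i) p
lattice-prefix-ballot {u} lat {i} 1≤i p s u≡ = extend [] p u≡ z≤n
  where
  Ballot : List Letter → Set
  Ballot q = occ (un (suc i)) q ≤ occ (un i) q

  snoc : ∀ q x t → u ≡ q ++ x ∷ t → Ballot q → Ballot (q ++ [ x ])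
  snoc q x t u≡q++x∷t ballot
    rewrite occ-++ (un (suc i)) q [ x ] | occ-++ (un i) q [ x ]
    with m≤n⇒m<n∨m≡n ballot
  ... | inj₁ lt = begin
    occ (un (suc i)) q + occ (un (suc i)) [ x ] ≤⟨ +-monoʳ-≤ _ (occ-[]≤1 (un (suc i)) x) ⟩
    occ (un (suc i)) q + 1                     ≡⟨ +-comm _ 1 ⟩
    suc (occ (un (suc i)) q)                   ≤⟨ lt ⟩
    occ (un i) q                               ≤⟨ m≤m+n _ _ ⟩
    occ (un i) q + occ (un i) [ x ]            ∎
    where open ≤-Reasoning
  ... | inj₂ tie = begin
    occ (un (suc i)) q + occ (un (suc i)) [ x ] ≡⟨ cong (_ +_) (occ-[]-≢ _ x x≢i+1) ⟩
    occ (un (suc i)) q + 0                     ≡⟨ +-identityʳ _ ⟩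
    occ (un (suc i)) q                         ≤⟨ ballot ⟩
    occ (un i) q                               ≤⟨ m≤m+n _ _ ⟩
    occ (un i) q + occ (un i) [ x ]            ∎
    where
    open ≤-Reasoning
    x≢i+1 : x ≢ un (suc i)
    x≢i+1 = proj₁ (lat q x t u≡q++x∷t i 1≤i (sym tie))

  extend : ∀ q r → u ≡ q ++ r ++ s → Ballot q → Ballot (q ++ r)
  extend q []      _         ballot = subst Ballot (sym (++-identityʳ q)) ballot
  extend q (x ∷ r) u≡q++x∷rs ballot =
    subst Ballot (++-assoc q [ x ] r)
      (extend (q ++ [ x ]) r (trans u≡q++x∷rs (sym (++-assoc q [ x ] (r ++ s))))
        (snoc q x (r ++ s) u≡q++x∷rs ballot))

reverse-++-∷ : ∀ {A : Set} (xs : List A) x ys →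
  reverse (xs ++ x ∷ ys) ≡ reverse ys ++ x ∷ reverse xs
reverse-++-∷ xs x ys = trans (++-ʳ++ xs) (ʳ++-defn ys)

rightmost-split : ∀ {W} → RightmostCond W → ∀ {i} → 1 ≤ occ (pr i) W →
  ∃₂ λ A S → W ≡ A ++ un i ∷ S × occ (pr i) S ≡ 0
rightmost-split {W} rm {i} i′∈W with split-last (pr i) W i′∈W
... | P , S , refl , i′∉S with ∈-∃++ (rm i P S refl)
... | S₁ , S₂ , refl =
  P ++ pr i ∷ S₁ , S₂ , sym (++-assoc P (pr i ∷ S₁) (un i ∷ S₂)) ,
  m+n≡0⇒n≡0 (occ (pr i) S₁) (trans (sym (occ-++ (pr i) S₁ (un i ∷ S₂))) i′∉S)

lattice-unprimed-after-primed-< : ∀ {W} → Lattice (W ++ map next (reverse W)) →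
  ∀ {i} → 1 ≤ i → ∀ A S → W ≡ A ++ un i ∷ S → occ (pr i) S ≡ 0 →
  occ (un (suc i)) W < occ (un i) W
lattice-unprimed-after-primed-< {W} lat {i} 1≤i A S refl i′∉S =
  conclude (m≤n⇒m<n∨m≡n ballot)
  where
  p rest : List Letter
  p    = W ++ map next (reverse S)
  rest = map next (reverse A)

  wŵ≡ : W ++ map next (reverse W) ≡ p ++ pr (suc i) ∷ rest
  wŵ≡ = begin
    W ++ map next (reverse W)                      ≡⟨ cong (λ r → W ++ map next r) (reverse-++-∷ A (un i) S) ⟩
    W ++ map next (reverse S ++ un i ∷ reverse A)  ≡⟨ cong (W ++_) (map-++ next (reverse S) (un i ∷ reverse A)) ⟩
    W ++ map next (reverse S) ++ pr (suc i) ∷ rest ≡⟨ ++-assoc W _ _ ⟨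
    p ++ pr (suc i) ∷ rest                         ∎
    where open ≡-Reasoning

  ballot : occ (un (suc i)) p ≤ occ (un i) p
  ballot = lattice-prefix-ballot lat 1≤i p _ wŵ≡

  i-in-p : occ (un i) p ≡ occ (un i) W
  i-in-p = begin
    occ (un i) p                                        ≡⟨ occ-++ (un i) W _ ⟩
    occ (un i) W + occ (un i) (map next (reverse S))    ≡⟨ cong (occ (un i) W +_) (occ-un-map-next i (reverse S)) ⟩
    occ (un i) W + occ (pr i) (reverse S)               ≡⟨ cong (occ (un i) W +_) (trans (occ-reverse (pr i) S) i′∉S) ⟩
    occ (un i) W + 0                                    ≡⟨ +-identityʳ _ ⟩
    occ (un i) W                                        ∎
    where open ≡-Reasoning

  i+1-in-p : occ (un (suc i)) W ≤ occ (un (suc i)) p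
  i+1-in-p = ≤-trans (m≤m+n _ _) (≤-reflexive (sym (occ-++ (un (suc i)) W _)))

  conclude : occ (un (suc i)) p < occ (un i) p ⊎ occ (un (suc i)) p ≡ occ (un i) p →
    occ (un (suc i)) W < occ (un i) W
  conclude (inj₁ lt)  = begin-strict
    occ (un (suc i)) W ≤⟨ i+1-in-p ⟩
    occ (un (suc i)) p <⟨ lt ⟩
    occ (un i) p       ≡⟨ i-in-p ⟩
    occ (un i) W       ∎
    where open ≤-Reasoning
  conclude (inj₂ tie) = contradiction refl (proj₂ (lat p (pr (suc i)) rest wŵ≡ i 1≤i (sym tie)))

≤-of-sum-excess : ∀ {a b c d} → a + b ≡ suc (c + d) → d < b → a ≤ c
≤-of-sum-excess {a} {b} {c} {d} sum≡ d<b = +-cancelʳ-≤ (suc d) a c (begin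
  a + suc d   ≤⟨ +-monoʳ-≤ a d<b ⟩
  a + b       ≡⟨ sum≡ ⟩
  suc (c + d) ≡⟨ +-suc c d ⟨
  c + suc d   ∎)
  where open ≤-Reasoning

mainTheorem8 : (T : Tableau) (j k : ℕ) → Amenable T →
    (∀ i → 1 ≤ i → i ≤ suc j → content T i + i ≡ suc k) →
    (∀ i → suc j < i → content T i ≡ 0) →
    ∀ i → 1 ≤ i → i ≤ j → occ (pr i) (w T) ≤ occ (pr (suc i)) (w T)
mainTheorem8 T j k (_ , _ , _ , _ , _ , lat , rm) content≡ _ i 1≤i i≤j = ≮⇒≥ λ fewer-i′ →
  let A , S , w≡ , i′∉S = rightmost-split rm (≤-trans (s≤s z≤n) fewer-i′) in
  <⇒≱ (lattice-unprimed-after-primed-< lat 1≤i A S w≡ i′∉S)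
      (≤-of-sum-excess content-drop fewer-i′)
  where
  content-drop : content T i ≡ suc (content T (suc i))
  content-drop = +-cancelʳ-≡ i _ _ (begin
    content T i + i           ≡⟨ content≡ i 1≤i (m≤n⇒m≤1+n i≤j) ⟩
    suc k                     ≡⟨ content≡ (suc i) (s≤s z≤n) (s≤s i≤j) ⟨
    content T (suc i) + suc i ≡⟨ +-suc _ i ⟩
    suc (content T (suc i)) + i ∎)
    where open ≡-Reasoning
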